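{- Let $A$ be an integral srl-monoid. Then the lattice $\mathrm{Con}(A)$ of congruences of $A$ is order isomorphic (under inclusion) to the set of $\square$-filters of $A$ ordered by inclusion, via $\theta\mapsto 1/\theta$ with inverse $H\mapsto\theta_H$, where $\theta_H=\{(a,b)\in A\times A: a\cdot h\leq b \text{ and } b\cdot h\leq a \text{ for some } h\in H\}$.
   Context: A commutative l-monoid is an algebra $(A,\wedge,\vee,\cdot,e)$ of type $(2,2,2,0)$ such that $(A,\wedge,\vee)$ is a lattice, $(A,\cdot,e)$ is a commutative monoid and $(a\vee b)\cdot c=(a\cdot c)\vee(b\cdot c)$ for all $a,b,c\in A$. An algebra $(A,\wedge,\vee,\cdot,\rightarrow,e)$ of type $(2,2,2,2,0)$ is an srl-monoid if $(A,\wedge,\vee,\cdot,e)$ is a commutative l-monoid and there is a subalgebra $Q$ of $(A,\wedge,\vee,\cdot,e)$ such that for all $a,b\in A$ the set $\{q\in Q: a\cdot q\leq b\}$ has a maximum and $a\rightarrow b$ equals this maximum. It is integral if it has a greatest element $1$ and $e=1$. Let $\square(a)=e\rightarrow a$. A $\square$-filter of integral $A$ is a subset $H$ with $1\in H$, $H$ upward closed, $a\cdot b\in H$ whenever $a,b\in H$, and $\square(a)\in H$ whenever $a\in H$. $1/\theta$ is the $\theta$-class of $1$. -}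

module Defs where

open import Level using (Level; _⊔_) renaming (suc to lsuc)
open import Data.Product using (Σ; _×_; _,_; ∃-syntax)
open import Relation.Binary.PropositionalEquality using (_≡_)
open import Relation.Binary.Structures using (IsEquivalence)
open import Algebra.Core using (Op₂)
open import Algebra.Structures using (IsCommutativeMonoid)
open import Algebra.Lattice.Structures using (IsLattice)

record SRLMonoid (c : Level) : Set (lsuc c) where
  infixr 6 _∨_
  infixr 7 _∧_
  infixl 8 _·_
  infixr 5 _⇒_
  infix 4 _≤_
  field
    Carrier : Set c
    _∧_ _∨_ _·_ _⇒_ : Op₂ Carrier
    e : Carrier
    isLattice : IsLattice _≡_ _∨_ _∧_
    isCommutativeMonoid : IsCommutativeMonoid _≡_ _·_ e
    ·-distrib-∨ : ∀ a b c → (a ∨ b) · c ≡ (a · c) ∨ (b · c)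

  _≤_ : Carrier → Carrier → Set c
  a ≤ b = a ∧ b ≡ a

  field
    Q : Carrier → Set c
    Q-e : Q e
    Q-∧ : ∀ {a b} → Q a → Q b → Q (a ∧ b)
    Q-∨ : ∀ {a b} → Q a → Q b → Q (a ∨ b)
    Q-· : ∀ {a b} → Q a → Q b → Q (a · b)
    ⇒-in-Q : ∀ a b → Q (a ⇒ b)
    ⇒-sat  : ∀ a b → a · (a ⇒ b) ≤ b
    ⇒-max  : ∀ a b q → Q q → a · q ≤ b → q ≤ (a ⇒ b)

  □ : Carrier → Carrier
  □ a = e ⇒ a

module _ {c : Level} (A : SRLMonoid c) where
  open SRLMonoid A

  -- integral: e is the greatest element (so 1 = e)
  Integral : Set c
  Integral = ∀ a → a ≤ e

  record IsCongruence (θ : Carrier → Carrier → Set c) : Set c where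
    field
      isEquivalence : IsEquivalence θ
      ∧-compat : ∀ {a b a' b'} → θ a b → θ a' b' → θ (a ∧ a') (b ∧ b')
      ∨-compat : ∀ {a b a' b'} → θ a b → θ a' b' → θ (a ∨ a') (b ∨ b')
      ·-compat : ∀ {a b a' b'} → θ a b → θ a' b' → θ (a · a') (b · b')
      ⇒-compat : ∀ {a b a' b'} → θ a b → θ a' b' → θ (a ⇒ a') (b ⇒ b')

  record IsBoxFilter (H : Carrier → Set c) : Set c where
    field
      one-in : H e
      up     : ∀ {a b} → H a → a ≤ b → H b
      ·-cl   : ∀ {a b} → H a → H b → H (a · b)
      □-cl   : ∀ {a} → H a → H (□ a)

  classOf1 : (Carrier → Carrier → Set c) → Carrier → Set c
  classOf1 θ a = θ a e

  θ_of : (Carrier → Set c) → Carrier → Carrier → Set c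
  θ_of H a b = ∃[ h ] (H h × (a · h ≤ b) × (b · h ≤ a))

  _⊆₁_ : (Carrier → Set c) → (Carrier → Set c) → Set c
  P ⊆₁ P' = ∀ {a} → P a → P' a

  _⊆₂_ : (Carrier → Carrier → Set c) → (Carrier → Carrier → Set c) → Set c
  θ ⊆₂ θ' = ∀ {a b} → θ a b → θ' a b

module Submission where

-- Integrality makes every product a · h lie below a, so a witness h ∈ H for a θ_H b can always be
-- replaced by a smaller one. This is what makes θ_H transitive and compatible with ∧, ∨ and ·
-- (take the product of the two witnesses). For ⇒ the witness must lie in Q; closure of H under
-- □ = e ⇒ _ provides □ (h · k), which lies in Q and below h · k. Conversely, in a congruence θ,
-- h θ 1 gives a · h θ a, and a θ b gives (a ⇒ b) · (b ⇒ a) θ 1; together these show that θ is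
-- recovered from its class of 1 as θ_(1/θ).

open import Defs
open import Level using (Level)
open import Data.Product using (_×_; _,_)
open import Function.Bundles using (_⇔_; mk⇔; Equivalence)
open import Relation.Binary.PropositionalEquality
  using (_≡_; refl; sym; trans; cong; cong₂; subst; subst₂; module ≡-Reasoning)
  renaming (isEquivalence to ≡-isEquivalence)
open import Relation.Binary.Bundles using (Poset)
open import Relation.Binary.Structures using (IsEquivalence)
open import Algebra.Core using (Op₂)
open import Algebra.Bundles using (CommutativeMonoid)
open import Algebra.Structures using (IsCommutativeMonoid)
open import Algebra.Lattice.Bundles using (Lattice)
open import Algebra.Lattice.Structures using (IsLattice)
import Algebra.Lattice.Properties.Lattice as LatticeProperties
import Algebra.Properties.CommutativeSemigroup as CommutativeSemigroupProperties
import Relation.Binary.Lattice as OrderTheoretic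
import Relation.Binary.Reasoning.PartialOrder as ≤-Reasoning

module Order {c : Level} (A : SRLMonoid c) where
  open SRLMonoid A
  open IsCommutativeMonoid isCommutativeMonoid using (assoc; comm; identityˡ)

  lattice : Lattice c c
  lattice = record { isLattice = isLattice }

  commutativeMonoid : CommutativeMonoid c c
  commutativeMonoid = record { isCommutativeMonoid = isCommutativeMonoid }

  open CommutativeSemigroupProperties (CommutativeMonoid.commutativeSemigroup commutativeMonoid)
    public using (interchange; x∙yz≈y∙xz)

  -- The library orders a lattice by x ≡ x ∧ y, which is _≤_ read backwards.
  private
    module L = OrderTheoretic.IsLattice
      (LatticeProperties.∨-∧-isOrderTheoreticLattice lattice)

  ≤-refl : ∀ {a} → a ≤ a
  ≤-refl = sym L.refl

  ≤-reflexive : ∀ {a b} → a ≡ b → a ≤ b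
  ≤-reflexive refl = ≤-refl

  ≤-trans : ∀ {a b d} → a ≤ b → b ≤ d → a ≤ d
  ≤-trans p q = sym (L.trans (sym p) (sym q))

  ≤-antisym : ∀ {a b} → a ≤ b → b ≤ a → a ≡ b
  ≤-antisym p q = L.antisym (sym p) (sym q)

  poset : Poset c c c
  poset = record
    { isPartialOrder = record
      { isPreorder = record
        { isEquivalence = ≡-isEquivalence ; reflexive = ≤-reflexive ; trans = ≤-trans }
      ; antisym = ≤-antisym
      }
    }

  x∧y≤x : ∀ a b → a ∧ b ≤ a
  x∧y≤x a b = sym (L.x∧y≤x a b)

  x∧y≤y : ∀ a b → a ∧ b ≤ b
  x∧y≤y a b = sym (L.x∧y≤y a b)

  ∧-greatest : ∀ {a b d} → d ≤ a → d ≤ b → d ≤ a ∧ b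
  ∧-greatest p q = sym (L.∧-greatest (sym p) (sym q))

  x≤x∨y : ∀ a b → a ≤ a ∨ b
  x≤x∨y a b = sym (L.x≤x∨y a b)

  y≤x∨y : ∀ a b → b ≤ a ∨ b
  y≤x∨y a b = sym (L.y≤x∨y a b)

  ∨-least : ∀ {a b d} → a ≤ d → b ≤ d → a ∨ b ≤ d
  ∨-least p q = sym (L.∨-least (sym p) (sym q))

  ∧-mono : ∀ {a b a' b'} → a ≤ b → a' ≤ b' → a ∧ a' ≤ b ∧ b'
  ∧-mono {a} {a' = a'} p q = ∧-greatest (≤-trans (x∧y≤x a a') p) (≤-trans (x∧y≤y a a') q)

  ≤⇒∨≡ : ∀ {a b} → a ≤ b → a ∨ b ≡ b
  ≤⇒∨≡ {a} {b} p = ≤-antisym (∨-least p ≤-refl) (y≤x∨y a b)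

  ∨≡⇒≤ : ∀ {a b} → a ∨ b ≡ b → a ≤ b
  ∨≡⇒≤ {a} {b} p = subst (a ≤_) p (x≤x∨y a b)

  ∨-mono : ∀ {a b a' b'} → a ≤ b → a' ≤ b' → a ∨ a' ≤ b ∨ b'
  ∨-mono {b = b} {b' = b'} p q = ∨-least (≤-trans p (x≤x∨y b b')) (≤-trans q (y≤x∨y b b'))

  ·-monoˡ : ∀ {a b} d → a ≤ b → a · d ≤ b · d
  ·-monoˡ {a} {b} d p = ∨≡⇒≤ (begin
    a · d ∨ b · d ≡⟨ sym (·-distrib-∨ a b d) ⟩
    (a ∨ b) · d   ≡⟨ cong (_· d) (≤⇒∨≡ p) ⟩
    b · d         ∎)
    where open ≡-Reasoning

  ·-monoʳ : ∀ {a b} d → a ≤ b → d · a ≤ d · b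
  ·-monoʳ {a} {b} d p = subst₂ _≤_ (comm a d) (comm b d) (·-monoˡ d p)

  ·-mono : ∀ {a b a' b'} → a ≤ b → a' ≤ b' → a · a' ≤ b · b'
  ·-mono {b = b} {a' = a'} p q = ≤-trans (·-monoˡ a' p) (·-monoʳ b q)

  SubInterchangeable : Op₂ Carrier → Set c
  SubInterchangeable _⊙_ = ∀ a a' h k → (a ⊙ a') · (h · k) ≤ (a · h) ⊙ (a' · k)

  ·-subInterchangeable : SubInterchangeable _·_
  ·-subInterchangeable a a' h k = ≤-reflexive (interchange a a' h k)

  ·-chain : ∀ {a b d h k} → a · h ≤ b → b · k ≤ d → a · (h · k) ≤ d
  ·-chain {a} {h = h} {k} ah≤b bk≤d =
    subst (_≤ _) (assoc a h k) (≤-trans (·-monoˡ k ah≤b) bk≤d)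

  □-deflationary : ∀ a → □ a ≤ a
  □-deflationary a = subst (_≤ a) (identityˡ (□ a)) (⇒-sat e a)

  ⇒-antitone-monotone-□ : ∀ {a b a' b' h k} → b · h ≤ a → a' · k ≤ b' →
                          (a ⇒ a') · □ (h · k) ≤ b ⇒ b'
  ⇒-antitone-monotone-□ {a} {b} {a'} {b'} {h} {k} bh≤a a'k≤b' =
    ⇒-max b b' _ (Q-· (⇒-in-Q a a') (⇒-in-Q e (h · k))) (begin
      b · ((a ⇒ a') · □ (h · k)) ≤⟨ ·-monoʳ b (·-monoʳ (a ⇒ a') (□-deflationary (h · k))) ⟩
      b · ((a ⇒ a') · (h · k))   ≡⟨ cong (b ·_) (x∙yz≈y∙xz (a ⇒ a') h k) ⟩
      b · (h · ((a ⇒ a') · k))   ≡⟨ sym (assoc b h _) ⟩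
      (b · h) · ((a ⇒ a') · k)   ≤⟨ ·-monoˡ _ bh≤a ⟩
      a · ((a ⇒ a') · k)         ≡⟨ sym (assoc a (a ⇒ a') k) ⟩
      (a · (a ⇒ a')) · k         ≤⟨ ·-monoˡ k (⇒-sat a a') ⟩
      a' · k                     ≤⟨ a'k≤b' ⟩
      b'                         ∎)
    where open ≤-Reasoning poset

  θ_of-mono : ∀ {H H'} → _⊆₁_ A H H' → _⊆₂_ A (θ_of A H) (θ_of A H')
  θ_of-mono H⊆H' (h , h∈H , ah≤b , bh≤a) = h , H⊆H' h∈H , ah≤b , bh≤a

module IntegralProperties {c : Level} (A : SRLMonoid c) (integral : Integral A) where
  open SRLMonoid A
  open Order A
  open IsLattice isLattice using (∨-comm)
  open IsCommutativeMonoid isCommutativeMonoid using (comm; identityˡ; identityʳ)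

  x·y≤x : ∀ a b → a · b ≤ a
  x·y≤x a b = subst (a · b ≤_) (identityʳ a) (·-monoʳ a (integral b))

  x·y≤y : ∀ a b → a · b ≤ b
  x·y≤y a b = subst (_≤ b) (comm b a) (x·y≤x b a)

  e∨x≡e : ∀ a → e ∨ a ≡ e
  e∨x≡e a = ≤-antisym (∨-least ≤-refl (integral a)) (x≤x∨y e a)

  x⇒x≡e : ∀ a → a ⇒ a ≡ e
  x⇒x≡e a = ≤-antisym (integral _) (⇒-max a a e Q-e (≤-reflexive (identityʳ a)))

  ⇒-sat-product : ∀ a b → a · ((a ⇒ b) · (b ⇒ a)) ≤ b
  ⇒-sat-product a b = ≤-trans (·-monoʳ a (x·y≤x _ _)) (⇒-sat a b)

  ∧-subInterchangeable : SubInterchangeable _∧_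
  ∧-subInterchangeable a a' h k =
    ∧-greatest (·-mono (x∧y≤x a a') (x·y≤x h k)) (·-mono (x∧y≤y a a') (x·y≤y h k))

  ∨-subInterchangeable : SubInterchangeable _∨_
  ∨-subInterchangeable a a' h k = subst (_≤ a · h ∨ a' · k) (sym (·-distrib-∨ a a' (h · k)))
    (∨-mono (·-monoʳ a (x·y≤x h k)) (·-monoʳ a' (x·y≤y h k)))

  module CongruenceProperties {θ : Carrier → Carrier → Set c} (C : IsCongruence A θ) where
    open IsCongruence C
    open IsEquivalence isEquivalence renaming (refl to θ-refl; sym to θ-sym; trans to θ-trans)

    classOf1-isBoxFilter : IsBoxFilter A (classOf1 A θ)
    classOf1-isBoxFilter = record
      { one-in = θ-refl
      ; up = λ {a} {b} aθe a≤b → subst₂ θ (≤⇒∨≡ a≤b) (e∨x≡e b) (∨-compat aθe (θ-refl {b}))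
      ; ·-cl = λ aθe bθe → subst (θ _) (identityˡ e) (·-compat aθe bθe)
      ; □-cl = λ aθe → subst (θ _) (x⇒x≡e e) (⇒-compat (θ-refl {e}) aθe)
      }

    ·-classOf1 : ∀ {h} a → θ h e → θ (a · h) a
    ·-classOf1 a hθe = subst (θ _) (identityʳ a) (·-compat (θ-refl {a}) hθe)

    ⇒-classOf1 : ∀ {a b} → θ a b → θ ((a ⇒ b) · (b ⇒ a)) e
    ⇒-classOf1 {a} {b} aθb =
      subst (θ _) (trans (cong₂ _·_ (x⇒x≡e b) (x⇒x≡e a)) (identityˡ e))
        (·-compat (⇒-compat aθb (θ-refl {b})) (⇒-compat (θ-sym aθb) (θ-refl {a})))

    -- a θ a ∨ b θ b, since a = a ∨ b · h and b = a · h ∨ b.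
    θ_of-classOf1⇔θ : ∀ a b → θ_of A (classOf1 A θ) a b ⇔ θ a b
    θ_of-classOf1⇔θ a b = mk⇔ to from
      where
        to : θ_of A (classOf1 A θ) a b → θ a b
        to (h , hθe , ah≤b , bh≤a) = θ-trans aθa∨b (θ-sym bθa∨b)
          where
            aθa∨b : θ a (a ∨ b)
            aθa∨b = subst (λ x → θ x (a ∨ b)) (trans (∨-comm _ _) (≤⇒∨≡ bh≤a))
                      (∨-compat (θ-refl {a}) (·-classOf1 b hθe))
            bθa∨b : θ b (a ∨ b)
            bθa∨b = subst (λ x → θ x (a ∨ b)) (≤⇒∨≡ ah≤b)
                      (∨-compat (·-classOf1 a hθe) (θ-refl {b}))
        from : θ a b → θ_of A (classOf1 A θ) a b
        from aθb = (a ⇒ b) · (b ⇒ a) , ⇒-classOf1 aθb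
                 , ⇒-sat-product a b
                 , subst (λ x → b · x ≤ a) (comm (b ⇒ a) (a ⇒ b)) (⇒-sat-product b a)

  module BoxFilterProperties {H : Carrier → Set c} (F : IsBoxFilter A H) where
    open IsBoxFilter F

    θ_of-compatible : ∀ (_⊙_ : Op₂ Carrier) →
                      (∀ {a b a' b'} → a ≤ b → a' ≤ b' → a ⊙ a' ≤ b ⊙ b') →
                      SubInterchangeable _⊙_ →
                      ∀ {a b a' b'} → θ_of A H a b → θ_of A H a' b' →
                      θ_of A H (a ⊙ a') (b ⊙ b')
    θ_of-compatible _⊙_ ⊙-mono ⊙-sub {a} {b} {a'} {b'}
                    (h , h∈H , ah≤b , bh≤a) (k , k∈H , a'k≤b' , b'k≤a') =
      h · k , ·-cl h∈H k∈H
      , ≤-trans (⊙-sub a a' h k) (⊙-mono ah≤b a'k≤b')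
      , ≤-trans (⊙-sub b b' h k) (⊙-mono bh≤a b'k≤a')

    θ_of-isCongruence : IsCongruence A (θ_of A H)
    θ_of-isCongruence = record
      { isEquivalence = record
        { refl = λ {a} → e , one-in , ≤-reflexive (identityʳ a) , ≤-reflexive (identityʳ a)
        ; sym = λ (h , h∈H , ah≤b , bh≤a) → h , h∈H , bh≤a , ah≤b
        ; trans = λ (h , h∈H , ah≤b , bh≤a) (k , k∈H , bk≤d , dk≤b) →
            h · k , ·-cl h∈H k∈H , ·-chain ah≤b bk≤d
            , subst (λ x → _ · x ≤ _) (comm k h) (·-chain dk≤b bh≤a)
        }
      ; ∧-compat = θ_of-compatible _∧_ ∧-mono ∧-subInterchangeable
      ; ∨-compat = θ_of-compatible _∨_ ∨-mono ∨-subInterchangeable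
      ; ·-compat = θ_of-compatible _·_ ·-mono ·-subInterchangeable
      ; ⇒-compat = λ (h , h∈H , ah≤b , bh≤a) (k , k∈H , a'k≤b' , b'k≤a') →
          □ (h · k) , □-cl (·-cl h∈H k∈H)
          , ⇒-antitone-monotone-□ bh≤a a'k≤b' , ⇒-antitone-monotone-□ ah≤b b'k≤a'
      }

    classOf1-θ_of⇔ : ∀ a → classOf1 A (θ_of A H) a ⇔ H a
    classOf1-θ_of⇔ a = mk⇔
      (λ (h , h∈H , _ , eh≤a) → up h∈H (subst (_≤ a) (identityˡ h) eh≤a))
      (λ a∈H → a , a∈H , integral _ , ≤-reflexive (identityˡ a))

  classOf1-⊆⇔⊆ : ∀ {θ θ'} → IsCongruence A θ → IsCongruence A θ' →
                 _⊆₂_ A θ θ' ⇔ _⊆₁_ A (classOf1 A θ) (classOf1 A θ')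
  classOf1-⊆⇔⊆ {θ} {θ'} C C' = mk⇔ (λ θ⊆θ' {a} → θ⊆θ' {a} {e}) reflect
    where
      reflect : _⊆₁_ A (classOf1 A θ) (classOf1 A θ') → _⊆₂_ A θ θ'
      reflect 1/θ⊆1/θ' {a} {b} aθb = Equivalence.to (recover C' a b)
        (θ_of-mono 1/θ⊆1/θ' (Equivalence.from (recover C a b) aθb))
        where recover = CongruenceProperties.θ_of-classOf1⇔θ

corollary3p10 : {c : Level} (A : SRLMonoid c) → Integral A →
    -- θ ↦ 1/θ maps congruences to □-filters
    (∀ θ → IsCongruence A θ → IsBoxFilter A (classOf1 A θ))
    -- H ↦ θ_H maps □-filters to congruences
    × (∀ H → IsBoxFilter A H → IsCongruence A (θ_of A H))
    -- the two maps are mutually inverse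
    × (∀ θ → IsCongruence A θ → ∀ a b → (θ_of A (classOf1 A θ) a b ⇔ θ a b))
    × (∀ H → IsBoxFilter A H → ∀ a → (classOf1 A (θ_of A H) a ⇔ H a))
    -- and order-preserving and order-reflecting (inclusion)
    × (∀ θ θ' → IsCongruence A θ → IsCongruence A θ' →
         ((_⊆₂_ A θ θ') ⇔ (_⊆₁_ A (classOf1 A θ) (classOf1 A θ'))))
corollary3p10 A integral =
    (λ _ C → CongruenceProperties.classOf1-isBoxFilter C)
  , (λ _ F → BoxFilterProperties.θ_of-isCongruence F)
  , (λ _ C → CongruenceProperties.θ_of-classOf1⇔θ C)
  , (λ _ F → BoxFilterProperties.classOf1-θ_of⇔ F)
  , (λ _ _ → classOf1-⊆⇔⊆)
  where open IntegralProperties A integral
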